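{- Let $m\geq 15$ and $k\geq1$ be integers and let $c(x)=1+\sum_{j\in\{2,3,4,7\}}(x^j+x^{m-j})\in\mathbb{F}_2[x]$. Then $\gcd(c(x^k),x^m-1)=1$ in $\mathbb{F}_2[x]$ if and only if $\gcd(m,3k)=\gcd(m,5k)=\gcd(m,k)$.
   Context: In the paper's terminology this says $\{2,3,4,7\}$ is a QBF-set with respect to $(n,k)$, $n=em$: a set $\mathcal{C}\subseteq\{1,\dots,\lfloor\frac{m-1}{2}\rfloor\}$ is a QBF-set if $c(x)=1+\sum_{j\in\mathcal{C}}(x^j+x^{m-j})$ satisfies $\gcd(c(x^k),x^m-1)=1$ over $\mathbb{F}_2$. -}

module Defs where

open import Data.Bool using (Bool; true; false; _xor_; _∧_)
open import Data.List using (List; []; _∷_; replicate; _++_; foldr; map)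
open import Data.Nat using (ℕ; zero; suc; _∸_)
open import Data.Product using (Σ)
open import Relation.Binary.PropositionalEquality using (_≡_)

-- Polynomials over F₂ = Bool (xor as +, ∧ as ·), as coefficient lists,
-- lowest degree first.  Trailing zeros allowed; equality is coefficientwise.
Poly : Set
Poly = List Bool

coeff : Poly → ℕ → Bool
coeff []      _       = false
coeff (a ∷ p) zero    = a
coeff (a ∷ p) (suc n) = coeff p n

infix 4 _≈_
_≈_ : Poly → Poly → Set
p ≈ q = ∀ n → coeff p n ≡ coeff q n

infixl 6 _+ₚ_
_+ₚ_ : Poly → Poly → Poly
[]      +ₚ q       = q
(a ∷ p) +ₚ []      = a ∷ p
(a ∷ p) +ₚ (b ∷ q) = (a xor b) ∷ (p +ₚ q)

scale : Bool → Poly → Poly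
scale a = map (a ∧_)

infixl 7 _*ₚ_
_*ₚ_ : Poly → Poly → Poly
[]      *ₚ q = []
(a ∷ p) *ₚ q = scale a q +ₚ (false ∷ (p *ₚ q))

zeroₚ : Poly
zeroₚ = []

oneₚ : Poly
oneₚ = true ∷ []

X^ : ℕ → Poly
X^ n = replicate n false ++ (true ∷ [])

-- evaluation / substitution: eval p q = p(q)
eval : Poly → Poly → Poly
eval []      q = zeroₚ
eval (a ∷ p) q = (a ∷ []) +ₚ (q *ₚ eval p q)

infix 4 _∣ₚ_
_∣ₚ_ : Poly → Poly → Set
d ∣ₚ p = Σ Poly (λ r → d *ₚ r ≈ p)

GcdOne : Poly → Poly → Set
GcdOne p q = ∀ d → d ∣ₚ p → d ∣ₚ q → d ∣ₚ oneₚ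

cPoly : List ℕ → ℕ → Poly
cPoly C m = foldr (λ j acc → acc +ₚ (X^ j +ₚ X^ (m ∸ j))) oneₚ C

-- x^m - 1 = x^m + 1 over F₂
xm-1 : ℕ → Poly
xm-1 m = X^ m +ₚ oneₚ

module Submission where

-- Write y = x^k.  Modulo x^m + 1 the polynomial x^7 c(x) reduces to
--   f = 1 + x^3 + x^4 + x^5 + x^7 + x^9 + x^10 + x^11 + x^14 = Φ₃ Φ₅³,
-- and x^7 is a unit, so c(y) is coprime to x^m + 1 iff Φ₃(y) and Φ₅(y) are.
-- For an odd prime p, Φ_p(y) is coprime to x^m + 1 iff gcd(m, pk) = gcd(m, k).
-- If the gcds agree, Bézout for binomials gives
--   x^k + 1 ∈ (x^m + 1, x^(pk) + 1) ⊆ (x^m + 1, Φ_p(y)),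
-- and Φ_p is invertible modulo x + 1.  Otherwise g = gcd(m, k) satisfies pg ∣ m
-- and p ∤ k/g; then y ≡ x^(rg) modulo x^(pg) + 1 for some 0 < r < p, so the
-- non-unit Φ_p(x^g) ∣ Φ_p(x^(rg)) divides both Φ_p(y) and x^m + 1.

open import Algebra using (CommutativeRing; CommutativeSemigroup)
open import Algebra.Structures using (IsCommutativeSemigroup)
open import Data.Bool using (Bool; true; false; _xor_; _∧_; T)
open import Data.Bool.Properties
  using (xor-assoc; xor-comm; xor-identityʳ; xor-same; ∧-zeroʳ; ∧-comm; ∧-assoc; ∧-distribˡ-xor)
open import Data.Empty using (⊥-elim)
open import Data.List using ([]; _∷_; replicate)
open import Data.Maybe using (nothing)
open import Data.Nat
  using (ℕ; zero; suc; _+_; _*_; _∸_; _≤_; _<_; s≤s; z≤n; _≟_; NonZero; ≢-nonZero; _%_; _/_)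
open import Data.Nat.Base using (nonTrivial⇒n>1)
open import Data.Nat.DivMod using (m≡m%n+[m/n]*n; m%n<n)
open import Data.Nat.Divisibility
  using (divides; ∣-trans; n∣m*n; m∣m*n; *-monoˡ-∣; *-cancelʳ-∣; ∣⇒≤; 0∣⇒≡0; m%n≡0⇒n∣m)
  renaming (_∣_ to _∣ℕ_)
open import Data.Nat.GCD
  using (gcd; gcd-GCD; module Bézout; gcd[m,n]∣m; gcd[m,n]∣n; gcd-greatest; c*gcd[m,n]≡gcd[cm,cn])
open import Data.Nat.Primality using (Prime; prime?; prime⇒irreducible; prime⇒nonZero; prime⇒nonTrivial)
import Data.Nat.Properties as ℕ
open import Data.Product using (Σ; _×_; _,_; proj₁; proj₂)
open import Data.Sum using (_⊎_; inj₁; inj₂)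
open import Data.Unit using (tt)
open import Function.Bundles using (_⇔_; mk⇔)
open import Level using (0ℓ)
open import Relation.Binary.Bundles using (Setoid)
open import Relation.Binary.PropositionalEquality using (_≡_; _≢_; refl; sym; trans; cong; cong₂; subst)
open import Relation.Binary.Structures using (IsEquivalence)
open import Relation.Nullary using (¬_; yes; no)
open import Relation.Nullary.Decidable using (from-yes)
open import Tactic.RingSolver using (solve-∀)
open import Tactic.RingSolver.Core.AlmostCommutativeRing using (AlmostCommutativeRing; fromCommutativeRing)

open import Defs

-- F₂[x] as a commutative ring

-- Coefficientwise equality as a record, so that both polynomials can be
-- inferred from a proof; the ring solver relies on this.
infix 4 _≋_
record _≋_ (p q : Poly) : Set where
  constructor mk≋
  field coeff≡ : p ≈ q
open _≋_ public

≋-refl : ∀ {p} → p ≋ p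
≋-refl = mk≋ λ _ → refl

≋-sym : ∀ {p q} → p ≋ q → q ≋ p
≋-sym (mk≋ e) = mk≋ λ n → sym (e n)

≋-trans : ∀ {p q r} → p ≋ q → q ≋ r → p ≋ r
≋-trans (mk≋ e) (mk≋ f) = mk≋ λ n → trans (e n) (f n)

∷-cong : ∀ {a b p q} → a ≡ b → p ≋ q → a ∷ p ≋ b ∷ q
∷-cong a≡b (mk≋ e) = mk≋ λ { zero → a≡b ; (suc n) → e n }

∷-tail : ∀ {a b p q} → a ∷ p ≋ b ∷ q → p ≋ q
∷-tail (mk≋ e) = mk≋ λ n → e (suc n)

∷-≋[]-tail : ∀ {a p} → a ∷ p ≋ [] → p ≋ []
∷-≋[]-tail (mk≋ e) = mk≋ λ n → e (suc n)

false∷-≋[] : ∀ {p} → p ≋ [] → false ∷ p ≋ []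
false∷-≋[] (mk≋ e) = mk≋ λ { zero → refl ; (suc n) → e n }

coeff-+ : ∀ p q n → coeff (p +ₚ q) n ≡ coeff p n xor coeff q n
coeff-+ []      q       n       = refl
coeff-+ (a ∷ p) []      n       = sym (xor-identityʳ _)
coeff-+ (a ∷ p) (b ∷ q) zero    = refl
coeff-+ (a ∷ p) (b ∷ q) (suc n) = coeff-+ p q n

coeff-scale : ∀ a p n → coeff (scale a p) n ≡ a ∧ coeff p n
coeff-scale a []      n       = sym (∧-zeroʳ a)
coeff-scale a (b ∷ p) zero    = refl
coeff-scale a (b ∷ p) (suc n) = coeff-scale a p n

+-cong : ∀ {p p' q q'} → p ≋ p' → q ≋ q' → p +ₚ q ≋ p' +ₚ q'
+-cong {p} {p'} {q} {q'} (mk≋ e) (mk≋ f) = mk≋ λ n →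
  trans (coeff-+ p q n) (trans (cong₂ _xor_ (e n) (f n)) (sym (coeff-+ p' q' n)))

+-assoc : ∀ p q r → (p +ₚ q) +ₚ r ≋ p +ₚ (q +ₚ r)
+-assoc p q r = mk≋ λ n → trans (coeff-+ (p +ₚ q) r n) (trans (cong (_xor coeff r n) (coeff-+ p q n))
  (trans (xor-assoc (coeff p n) (coeff q n) (coeff r n))
         (sym (trans (coeff-+ p (q +ₚ r) n) (cong (coeff p n xor_) (coeff-+ q r n))))))

+-comm : ∀ p q → p +ₚ q ≋ q +ₚ p
+-comm p q = mk≋ λ n →
  trans (coeff-+ p q n) (trans (xor-comm (coeff p n) (coeff q n)) (sym (coeff-+ q p n)))

+-identityˡ : ∀ p → [] +ₚ p ≋ p
+-identityˡ p = ≋-refl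

+-identityʳ : ∀ p → p +ₚ [] ≋ p
+-identityʳ p = mk≋ λ n → trans (coeff-+ p [] n) (xor-identityʳ _)

+-self : ∀ p → p +ₚ p ≋ []
+-self p = mk≋ λ n → trans (coeff-+ p p n) (xor-same (coeff p n))

≋-isEquivalence : IsEquivalence _≋_
≋-isEquivalence = record { refl = ≋-refl ; sym = ≋-sym ; trans = ≋-trans }

≋-setoid : Setoid 0ℓ 0ℓ
≋-setoid = record { isEquivalence = ≋-isEquivalence }

open import Relation.Binary.Reasoning.Setoid ≋-setoid using (begin_; step-≈-⟩; step-≈-⟨; _∎)

+-isCommutativeSemigroup : IsCommutativeSemigroup _≋_ _+ₚ_
+-isCommutativeSemigroup = record
  { isSemigroup = record
    { isMagma = record { isEquivalence = ≋-isEquivalence ; ∙-cong = +-cong }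
    ; assoc = +-assoc }
  ; comm = +-comm }

+-commutativeSemigroup : CommutativeSemigroup 0ℓ 0ℓ
+-commutativeSemigroup = record { isCommutativeSemigroup = +-isCommutativeSemigroup }

open import Algebra.Properties.CommutativeSemigroup +-commutativeSemigroup
  using () renaming (interchange to +-interchange; x∙yz≈y∙xz to +-left-comm)

scale-cong : ∀ a {p q} → p ≋ q → scale a p ≋ scale a q
scale-cong a {p} {q} (mk≋ e) = mk≋ λ n →
  trans (coeff-scale a p n) (trans (cong (a ∧_) (e n)) (sym (coeff-scale a q n)))

scale-true : ∀ p → scale true p ≋ p
scale-true p = mk≋ (coeff-scale true p)

scale-false : ∀ p → scale false p ≋ []
scale-false p = mk≋ (coeff-scale false p)

scale-+ : ∀ a p q → scale a (p +ₚ q) ≋ scale a p +ₚ scale a q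
scale-+ a p q = mk≋ λ n → trans (coeff-scale a (p +ₚ q) n) (trans (cong (a ∧_) (coeff-+ p q n))
  (trans (∧-distribˡ-xor a (coeff p n) (coeff q n))
         (sym (trans (coeff-+ (scale a p) (scale a q) n) (cong₂ _xor_ (coeff-scale a p n) (coeff-scale a q n))))))

scale-scale : ∀ a b p → scale a (scale b p) ≋ scale (a ∧ b) p
scale-scale a b p = mk≋ λ n → trans (coeff-scale a (scale b p) n) (trans (cong (a ∧_) (coeff-scale b p n))
  (trans (sym (∧-assoc a b (coeff p n))) (sym (coeff-scale (a ∧ b) p n))))

*-congʳ : ∀ p {q q'} → q ≋ q' → p *ₚ q ≋ p *ₚ q'
*-congʳ []      e = ≋-refl
*-congʳ (a ∷ p) e = +-cong (scale-cong a e) (∷-cong refl (*-congʳ p e))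

*-zeroʳ : ∀ p → p *ₚ [] ≋ []
*-zeroʳ []      = ≋-refl
*-zeroʳ (a ∷ p) = false∷-≋[] (*-zeroʳ p)

*-∷ʳ : ∀ p b q → p *ₚ (b ∷ q) ≋ scale b p +ₚ (false ∷ p *ₚ q)
*-∷ʳ []      b q = ≋-sym (false∷-≋[] ≋-refl)
*-∷ʳ (a ∷ p) b q = ∷-cong (cong (_xor false) (∧-comm a b))
  (≋-trans (+-cong ≋-refl (*-∷ʳ p b q)) (+-left-comm (scale a q) (scale b p) (false ∷ p *ₚ q)))

*-comm : ∀ p q → p *ₚ q ≋ q *ₚ p
*-comm []      q = ≋-sym (*-zeroʳ q)
*-comm (a ∷ p) q = ≋-trans (+-cong ≋-refl (∷-cong refl (*-comm p q))) (≋-sym (*-∷ʳ q a p))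

*-congˡ : ∀ {p p'} q → p ≋ p' → p *ₚ q ≋ p' *ₚ q
*-congˡ {p} {p'} q e = ≋-trans (*-comm p q) (≋-trans (*-congʳ q e) (*-comm q p'))

*-cong : ∀ {p p' q q'} → p ≋ p' → q ≋ q' → p *ₚ q ≋ p' *ₚ q'
*-cong {p' = p'} {q} e f = ≋-trans (*-congˡ q e) (*-congʳ p' f)

*-distribˡ-+ : ∀ p q r → p *ₚ (q +ₚ r) ≋ p *ₚ q +ₚ p *ₚ r
*-distribˡ-+ []      q r = ≋-refl
*-distribˡ-+ (a ∷ p) q r = ≋-trans (+-cong (scale-+ a q r) (∷-cong refl (*-distribˡ-+ p q r)))
  (+-interchange (scale a q) (scale a r) (false ∷ p *ₚ q) (false ∷ p *ₚ r))

*-distribʳ-+ : ∀ p q r → (q +ₚ r) *ₚ p ≋ q *ₚ p +ₚ r *ₚ p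
*-distribʳ-+ p q r = ≋-trans (*-comm (q +ₚ r) p)
  (≋-trans (*-distribˡ-+ p q r) (+-cong (*-comm p q) (*-comm p r)))

scale-* : ∀ a p q → scale a p *ₚ q ≋ scale a (p *ₚ q)
scale-* a []      q = ≋-refl
scale-* a (b ∷ p) q = ≋-trans (+-cong (≋-sym (scale-scale a b q)) (∷-cong (sym (∧-zeroʳ a)) (scale-* a p q)))
  (≋-sym (scale-+ a (scale b q) (false ∷ p *ₚ q)))

false∷-* : ∀ p q → (false ∷ p) *ₚ q ≋ false ∷ p *ₚ q
false∷-* p q = +-cong (scale-false q) ≋-refl

*-assoc : ∀ p q r → (p *ₚ q) *ₚ r ≋ p *ₚ (q *ₚ r)
*-assoc []      q r = ≋-refl
*-assoc (a ∷ p) q r = ≋-trans (*-distribʳ-+ r (scale a q) (false ∷ p *ₚ q))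
  (+-cong (scale-* a q r) (≋-trans (false∷-* (p *ₚ q) r) (∷-cong refl (*-assoc p q r))))

*-identityˡ : ∀ p → oneₚ *ₚ p ≋ p
*-identityˡ p = ≋-trans (+-cong (scale-true p) (false∷-≋[] ≋-refl)) (+-identityʳ p)

*-identityʳ : ∀ p → p *ₚ oneₚ ≋ p
*-identityʳ p = ≋-trans (*-comm p oneₚ) (*-identityˡ p)

F₂[x] : CommutativeRing 0ℓ 0ℓ
F₂[x] = record
  { Carrier = Poly ; _≈_ = _≋_ ; _+_ = _+ₚ_ ; _*_ = _*ₚ_ ; -_ = λ p → p ; 0# = [] ; 1# = oneₚ
  ; isCommutativeRing = record
    { isRing = record
      { +-isAbelianGroup = record
        { isGroup = record
          { isMonoid = record
            { isSemigroup = IsCommutativeSemigroup.isSemigroup +-isCommutativeSemigroup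
            ; identity = +-identityˡ , +-identityʳ }
          ; inverse = +-self , +-self
          ; ⁻¹-cong = λ e → e }
        ; comm = +-comm }
      ; *-cong = *-cong
      ; *-assoc = *-assoc
      ; *-identity = *-identityˡ , *-identityʳ
      ; distrib = *-distribˡ-+ , *-distribʳ-+ }
    ; *-comm = *-comm } }

F₂[x]-solver : AlmostCommutativeRing 0ℓ 0ℓ
F₂[x]-solver = fromCommutativeRing F₂[x] (λ _ → nothing)

isZero : Poly → Bool
isZero []          = true
isZero (true ∷ p)  = false
isZero (false ∷ p) = isZero p

isZero-sound : ∀ p → T (isZero p) → p ≋ []
isZero-sound []          _ = ≋-refl
isZero-sound (false ∷ p) t = false∷-≋[] (isZero-sound p t)

-- The ring solver works in characteristic 0: identities that need 2 = 0 are
-- proved up to a doubled term, which is then cancelled.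
+-double : ∀ p q → p +ₚ (q +ₚ q) ≋ p
+-double p q = ≋-trans (+-cong ≋-refl (+-self q)) (+-identityʳ p)

+-cancelʳ : ∀ p q → (p +ₚ q) +ₚ q ≋ p
+-cancelʳ p q = ≋-trans (+-assoc p q q) (+-double p q)

+-move : ∀ {p q r} → p ≋ q +ₚ r → r ≋ p +ₚ q
+-move {p} {q} {r} e = ≋-sym (≋-trans (+-cong e ≋-refl)
  (≋-trans (+-cong (+-comm q r) ≋-refl) (+-cancelʳ r q)))

+≋[]⇒≋ : ∀ {p q} → p +ₚ q ≋ [] → p ≋ q
+≋[]⇒≋ {p} {q} e = ≋-trans (≋-sym (+-cancelʳ p q)) (≋-trans (+-cong e ≋-refl) (+-identityˡ q))

≋-by-evaluation : ∀ p q → T (isZero (p +ₚ q)) → p ≋ q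
≋-by-evaluation p q t = +≋[]⇒≋ (isZero-sound (p +ₚ q) t)

X^-+ : ∀ a b → X^ (a + b) ≋ X^ a *ₚ X^ b
X^-+ zero    b = ≋-sym (*-identityˡ (X^ b))
X^-+ (suc a) b = ≋-trans (∷-cong refl (X^-+ a b)) (≋-sym (false∷-* (X^ a) (X^ b)))

eval-+ : ∀ p q z → eval (p +ₚ q) z ≋ eval p z +ₚ eval q z
eval-+ []      q       z = ≋-refl
eval-+ (a ∷ p) []      z = ≋-sym (+-identityʳ _)
eval-+ (a ∷ p) (b ∷ q) z = ≋-trans (+-cong ≋-refl (*-congʳ z (eval-+ p q z)))
  (regroup (a ∷ []) (b ∷ []) z (eval p z) (eval q z))
  where regroup : ∀ a b z u v → (a +ₚ b) +ₚ z *ₚ (u +ₚ v) ≋ (a +ₚ z *ₚ u) +ₚ (b +ₚ z *ₚ v)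
        regroup = solve-∀ F₂[x]-solver

eval-scale : ∀ a p z → eval (scale a p) z ≋ (a ∷ []) *ₚ eval p z
eval-scale a []      z = ≋-sym (*-zeroʳ (a ∷ []))
eval-scale a (b ∷ p) z = ≋-trans (+-cong ∧-as-* (*-congʳ z (eval-scale a p z)))
  (regroup (a ∷ []) (b ∷ []) z (eval p z))
  where ∧-as-* : (a ∧ b) ∷ [] ≋ (a ∷ []) *ₚ (b ∷ [])
        ∧-as-* = ∷-cong (sym (xor-identityʳ _)) ≋-refl
        regroup : ∀ a b z u → a *ₚ b +ₚ z *ₚ (a *ₚ u) ≋ a *ₚ (b +ₚ z *ₚ u)
        regroup = solve-∀ F₂[x]-solver

eval-false∷ : ∀ p z → eval (false ∷ p) z ≋ z *ₚ eval p z
eval-false∷ p z = +-cong (false∷-≋[] ≋-refl) ≋-refl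

eval-* : ∀ p q z → eval (p *ₚ q) z ≋ eval p z *ₚ eval q z
eval-* []      q z = ≋-refl
eval-* (a ∷ p) q z = ≋-trans (eval-+ (scale a q) (false ∷ p *ₚ q) z)
  (≋-trans (+-cong (eval-scale a q z) (≋-trans (eval-false∷ (p *ₚ q) z) (*-congʳ z (eval-* p q z))))
  (regroup (a ∷ []) (eval q z) z (eval p z)))
  where regroup : ∀ a v z u → a *ₚ v +ₚ z *ₚ (u *ₚ v) ≋ (a +ₚ z *ₚ u) *ₚ v
        regroup = solve-∀ F₂[x]-solver

eval-≋[] : ∀ {p} z → p ≋ [] → eval p z ≋ []
eval-≋[] {[]}    z e = ≋-refl
eval-≋[] {a ∷ p} z e with coeff≡ e zero
... | refl = ≋-trans (eval-false∷ p z) (≋-trans (*-congʳ z (eval-≋[] z (∷-≋[]-tail e))) (*-zeroʳ z))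

eval-congˡ : ∀ {p q} z → p ≋ q → eval p z ≋ eval q z
eval-congˡ {[]}    {q}     z e = ≋-sym (eval-≋[] z (≋-sym e))
eval-congˡ {a ∷ p} {[]}    z e = eval-≋[] z e
eval-congˡ {a ∷ p} {b ∷ q} z e = +-cong (∷-cong (coeff≡ e zero) ≋-refl) (*-congʳ z (eval-congˡ z (∷-tail e)))

eval-congʳ : ∀ φ {z z'} → z ≋ z' → eval φ z ≋ eval φ z'
eval-congʳ []      e = ≋-refl
eval-congʳ (a ∷ φ) e = +-cong ≋-refl (*-cong e (eval-congʳ φ e))

eval-const : ∀ a z → eval (a ∷ []) z ≋ a ∷ []
eval-const a z = ≋-trans (+-cong ≋-refl (*-zeroʳ z)) (+-identityʳ _)

eval-eval : ∀ p q z → eval (eval p q) z ≋ eval p (eval q z)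
eval-eval []      q z = ≋-refl
eval-eval (a ∷ p) q z = ≋-trans (eval-+ (a ∷ []) (q *ₚ eval p q) z)
  (+-cong (eval-const a z) (≋-trans (eval-* q (eval p q) z) (*-congʳ (eval q z) (eval-eval p q z))))

eval-X^-X^ : ∀ a b → eval (X^ a) (X^ b) ≋ X^ (a * b)
eval-X^-X^ zero    b = eval-const true (X^ b)
eval-X^-X^ (suc a) b = ≋-trans (eval-false∷ (X^ a) (X^ b)) (≋-trans (*-congʳ (X^ b) (eval-X^-X^ a b))
  (≋-sym (X^-+ b (a * b))))

eval-xm-1-X^ : ∀ a b → eval (xm-1 a) (X^ b) ≋ xm-1 (a * b)
eval-xm-1-X^ a b = ≋-trans (eval-+ (X^ a) oneₚ (X^ b)) (+-cong (eval-X^-X^ a b) (eval-const true (X^ b)))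

-- Divisibility and two-generator ideals

infix 4 _∣ᵖ_ _∈⟨_,_⟩

record _∣ᵖ_ (d p : Poly) : Set where
  constructor mk∣
  field
    quotient : Poly
    equality : d *ₚ quotient ≋ p

record _∈⟨_,_⟩ (p a b : Poly) : Set where
  constructor mk∈
  field
    coeffˡ coeffʳ : Poly
    equality      : coeffˡ *ₚ a +ₚ coeffʳ *ₚ b ≋ p

∣ᵖ-refl : ∀ {d} → d ∣ᵖ d
∣ᵖ-refl {d} = mk∣ oneₚ (*-identityʳ d)

∣ᵖ-resp-≋ : ∀ {d p q} → p ≋ q → d ∣ᵖ p → d ∣ᵖ q
∣ᵖ-resp-≋ e (mk∣ r h) = mk∣ r (≋-trans h e)

∣ᵖ-trans : ∀ {d p q} → d ∣ᵖ p → p ∣ᵖ q → d ∣ᵖ q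
∣ᵖ-trans {d} (mk∣ r h) (mk∣ s k) = mk∣ (r *ₚ s) (≋-trans (≋-sym (*-assoc d r s)) (≋-trans (*-congˡ s h) k))

∣ᵖ-* : ∀ d c → d ∣ᵖ d *ₚ c
∣ᵖ-* d c = mk∣ c ≋-refl

∣ᵖ-+ : ∀ {d p q} → d ∣ᵖ p → d ∣ᵖ q → d ∣ᵖ p +ₚ q
∣ᵖ-+ {d} (mk∣ r h) (mk∣ s k) = mk∣ (r +ₚ s) (≋-trans (*-distribˡ-+ d r s) (+-cong h k))

∣ᵖ-eval : ∀ {d p} z → d ∣ᵖ p → eval d z ∣ᵖ eval p z
∣ᵖ-eval {d} z (mk∣ r h) = mk∣ (eval r z) (≋-trans (≋-sym (eval-* d r z)) (eval-congˡ z h))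

∣ᵖ-∈⟨⟩ : ∀ {d a b p} → d ∣ᵖ a → d ∣ᵖ b → p ∈⟨ a , b ⟩ → d ∣ᵖ p
∣ᵖ-∈⟨⟩ {d} (mk∣ r h) (mk∣ s k) (mk∈ u v e) = mk∣ (u *ₚ r +ₚ v *ₚ s)
  (≋-trans (regroup d r s u v) (≋-trans (+-cong (*-congʳ u h) (*-congʳ v k)) e))
  where regroup : ∀ d r s u v → d *ₚ (u *ₚ r +ₚ v *ₚ s) ≋ u *ₚ (d *ₚ r) +ₚ v *ₚ (d *ₚ s)
        regroup = solve-∀ F₂[x]-solver

∈⟨⟩-resp-≋ : ∀ {p q a b} → p ≋ q → p ∈⟨ a , b ⟩ → q ∈⟨ a , b ⟩
∈⟨⟩-resp-≋ e (mk∈ u v h) = mk∈ u v (≋-trans h e)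

∣ᵖ⇒∈⟨⟩ˡ : ∀ {a p} b → a ∣ᵖ p → p ∈⟨ a , b ⟩
∣ᵖ⇒∈⟨⟩ˡ {a} b (mk∣ r h) = mk∈ r [] (≋-trans (+-cong (*-comm r a) ≋-refl) (≋-trans (+-identityʳ _) h))

∣ᵖ⇒∈⟨⟩ʳ : ∀ {b p} a → b ∣ᵖ p → p ∈⟨ a , b ⟩
∣ᵖ⇒∈⟨⟩ʳ {b} a (mk∣ r h) = mk∈ [] r (≋-trans (*-comm r b) h)

∈⟨⟩-+ : ∀ {p q a b} → p ∈⟨ a , b ⟩ → q ∈⟨ a , b ⟩ → p +ₚ q ∈⟨ a , b ⟩
∈⟨⟩-+ {a = a} {b} (mk∈ u v h) (mk∈ u' v' h') =
  mk∈ (u +ₚ u') (v +ₚ v') (≋-trans (regroup u u' v v' a b) (+-cong h h'))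
  where regroup : ∀ u u' v v' a b →
                  (u +ₚ u') *ₚ a +ₚ (v +ₚ v') *ₚ b ≋ (u *ₚ a +ₚ v *ₚ b) +ₚ (u' *ₚ a +ₚ v' *ₚ b)
        regroup = solve-∀ F₂[x]-solver

∈⟨⟩-*ˡ : ∀ {p a b} c → p ∈⟨ a , b ⟩ → c *ₚ p ∈⟨ a , b ⟩
∈⟨⟩-*ˡ {a = a} {b} c (mk∈ u v h) = mk∈ (c *ₚ u) (c *ₚ v) (≋-trans (regroup c u v a b) (*-congʳ c h))
  where regroup : ∀ c u v a b → (c *ₚ u) *ₚ a +ₚ (c *ₚ v) *ₚ b ≋ c *ₚ (u *ₚ a +ₚ v *ₚ b)
        regroup = solve-∀ F₂[x]-solver

∈⟨⟩-∣ᵖ : ∀ {p q a b} → p ∈⟨ a , b ⟩ → p ∣ᵖ q → q ∈⟨ a , b ⟩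
∈⟨⟩-∣ᵖ {p} i (mk∣ r h) = ∈⟨⟩-resp-≋ (≋-trans (*-comm r p) h) (∈⟨⟩-*ˡ r i)

∈⟨⟩-transˡ : ∀ {p a b c} → p ∈⟨ a , b ⟩ → a ∈⟨ c , b ⟩ → p ∈⟨ c , b ⟩
∈⟨⟩-transˡ {b = b} (mk∈ u v h) i =
  ∈⟨⟩-resp-≋ h (∈⟨⟩-+ (∈⟨⟩-*ˡ u i) (∣ᵖ⇒∈⟨⟩ʳ _ (mk∣ v (*-comm b v))))

∈⟨⟩-transʳ : ∀ {p a b c} → p ∈⟨ a , b ⟩ → b ∈⟨ a , c ⟩ → p ∈⟨ a , c ⟩
∈⟨⟩-transʳ {a = a} (mk∈ u v h) i =
  ∈⟨⟩-resp-≋ h (∈⟨⟩-+ (∣ᵖ⇒∈⟨⟩ˡ _ (mk∣ u (*-comm a u))) (∈⟨⟩-*ˡ v i))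

∈⟨⟩-* : ∀ {p q a b c} → p ∈⟨ a , b ⟩ → q ∈⟨ a , c ⟩ → p *ₚ q ∈⟨ a , b *ₚ c ⟩
∈⟨⟩-* {a = a} {b} {c} (mk∈ u v h) (mk∈ u' v' h') =
  mk∈ (u *ₚ (u' *ₚ a +ₚ v' *ₚ c) +ₚ v *ₚ b *ₚ u') (v *ₚ v')
      (≋-trans (regroup u v u' v' a b c) (*-cong h h'))
  where regroup : ∀ u v u' v' a b c →
                  (u *ₚ (u' *ₚ a +ₚ v' *ₚ c) +ₚ v *ₚ b *ₚ u') *ₚ a +ₚ (v *ₚ v') *ₚ (b *ₚ c)
                    ≋ (u *ₚ a +ₚ v *ₚ b) *ₚ (u' *ₚ a +ₚ v' *ₚ c)
        regroup = solve-∀ F₂[x]-solver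

∈⟨⟩-resp-≋ˡ : ∀ {p a a' b} → a ≋ a' → p ∈⟨ a , b ⟩ → p ∈⟨ a' , b ⟩
∈⟨⟩-resp-≋ˡ e (mk∈ u v h) = mk∈ u v (≋-trans (+-cong (*-congʳ u (≋-sym e)) ≋-refl) h)

∈⟨⟩-resp-≋ʳ : ∀ {p a b b'} → b ≋ b' → p ∈⟨ a , b ⟩ → p ∈⟨ a , b' ⟩
∈⟨⟩-resp-≋ʳ e (mk∈ u v h) = mk∈ u v (≋-trans (+-cong ≋-refl (*-congʳ v (≋-sym e))) h)

∈⟨⟩-∣ˡ : ∀ {p a a' b} → a ∣ᵖ a' → p ∈⟨ a' , b ⟩ → p ∈⟨ a , b ⟩
∈⟨⟩-∣ˡ a∣a' i = ∈⟨⟩-transˡ i (∣ᵖ⇒∈⟨⟩ˡ _ a∣a')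

∈⟨⟩-∣ʳ : ∀ {p a b b'} → b ∣ᵖ b' → p ∈⟨ a , b' ⟩ → p ∈⟨ a , b ⟩
∈⟨⟩-∣ʳ b∣b' i = ∈⟨⟩-transʳ i (∣ᵖ⇒∈⟨⟩ʳ _ b∣b')

∈⟨⟩-one-* : ∀ {a b c} → oneₚ ∈⟨ a , b ⟩ → oneₚ ∈⟨ a , c ⟩ → oneₚ ∈⟨ a , b *ₚ c ⟩
∈⟨⟩-one-* i j = ∈⟨⟩-resp-≋ (*-identityˡ oneₚ) (∈⟨⟩-* i j)

∈⟨⟩-eval : ∀ {p a b} z → p ∈⟨ a , b ⟩ → eval p z ∈⟨ eval a z , eval b z ⟩
∈⟨⟩-eval {p} {a} {b} z (mk∈ u v h) = mk∈ (eval u z) (eval v z)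
  (≋-trans (+-cong (≋-sym (eval-* u a z)) (≋-sym (eval-* v b z)))
           (≋-trans (≋-sym (eval-+ (u *ₚ a) (v *ₚ b) z)) (eval-congˡ z h)))

+≋*⇒∈⟨⟩ : ∀ {p q r a} → p +ₚ q ≋ r *ₚ a → p ∈⟨ a , q ⟩
+≋*⇒∈⟨⟩ {p} {q} {r} e = mk∈ r oneₚ
  (≋-trans (+-cong (≋-sym e) (*-identityˡ q)) (+-cancelʳ p q))

∣ᵖ⇒∣ₚ : ∀ {d p} → d ∣ᵖ p → d ∣ₚ p
∣ᵖ⇒∣ₚ (mk∣ r e) = r , coeff≡ e

∣ₚ⇒∣ᵖ : ∀ {d p} → d ∣ₚ p → d ∣ᵖ p
∣ₚ⇒∣ᵖ (r , e) = mk∣ r (mk≋ e)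

∈⟨⟩⇒GcdOne : ∀ {a p} → oneₚ ∈⟨ a , p ⟩ → GcdOne p a
∈⟨⟩⇒GcdOne i d d∣p d∣a = ∣ᵖ⇒∣ₚ (∣ᵖ-∈⟨⟩ {d} (∣ₚ⇒∣ᵖ d∣a) (∣ₚ⇒∣ᵖ d∣p) i)

xm-1-+ : ∀ a b → xm-1 (a + b) ≋ X^ a *ₚ xm-1 b +ₚ xm-1 a
xm-1-+ a b = ≋-trans (+-cong (X^-+ a b) ≋-refl)
  (≋-sym (≋-trans (regroup (X^ a) (X^ b)) (+-double _ (X^ a))))
  where regroup : ∀ u v → u *ₚ (v +ₚ oneₚ) +ₚ (u +ₚ oneₚ) ≋ (u *ₚ v +ₚ oneₚ) +ₚ (u +ₚ u)
        regroup = solve-∀ F₂[x]-solver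

xm-1-*-∣ : ∀ a c → xm-1 a ∣ᵖ xm-1 (c * a)
xm-1-*-∣ a zero    = mk∣ [] (≋-trans (*-zeroʳ (xm-1 a)) (≋-sym (false∷-≋[] ≋-refl)))
xm-1-*-∣ a (suc c) = ∣ᵖ-resp-≋ (≋-sym (xm-1-+ a (c * a)))
  (∣ᵖ-+ (∣ᵖ-resp-≋ (*-comm _ (X^ a)) (∣ᵖ-trans (xm-1-*-∣ a c) (∣ᵖ-* _ (X^ a)))) ∣ᵖ-refl)

xm-1-∣ : ∀ {a b} → a ∣ℕ b → xm-1 a ∣ᵖ xm-1 b
xm-1-∣ {a} (divides c refl) = xm-1-*-∣ a c

xm-1-∈⟨⟩-∸ : ∀ {d c e a b} → d + c ≡ e →
             xm-1 e ∈⟨ a , b ⟩ → xm-1 c ∈⟨ a , b ⟩ → xm-1 d ∈⟨ a , b ⟩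
xm-1-∈⟨⟩-∸ {d} {c} refl ie ic =
  ∈⟨⟩-resp-≋ (≋-sym (+-move (xm-1-+ d c))) (∈⟨⟩-+ ie (∈⟨⟩-*ˡ (X^ d) ic))

xm-1-gcd : ∀ a b → xm-1 (gcd a b) ∈⟨ xm-1 a , xm-1 b ⟩
xm-1-gcd a b with Bézout.identity (gcd-GCD a b)
... | Bézout.+- x y eq = xm-1-∈⟨⟩-∸ eq (multipleˡ x) (multipleʳ y)
  where multipleˡ = λ x → ∣ᵖ⇒∈⟨⟩ˡ (xm-1 b) (xm-1-∣ (divides x refl))
        multipleʳ = λ y → ∣ᵖ⇒∈⟨⟩ʳ (xm-1 a) (xm-1-∣ (divides y refl))
... | Bézout.-+ x y eq = xm-1-∈⟨⟩-∸ eq (multipleʳ y) (multipleˡ x)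
  where multipleˡ = λ x → ∣ᵖ⇒∈⟨⟩ˡ (xm-1 b) (xm-1-∣ (divides x refl))
        multipleʳ = λ y → ∣ᵖ⇒∈⟨⟩ʳ (xm-1 a) (xm-1-∣ (divides y refl))

X^-unit : ∀ {a b} p → a ≤ b → p ∈⟨ xm-1 b , X^ a *ₚ p ⟩
X^-unit {a} {b} p a≤b = mk∈ p (X^ (b ∸ a)) (≋-trans (+-cong (*-congʳ p (+-cong X^b ≋-refl)) ≋-refl)
  (≋-trans (regroup p (X^ (b ∸ a)) (X^ a)) (+-double p ((X^ (b ∸ a) *ₚ X^ a) *ₚ p))))
  where
  X^b : X^ b ≋ X^ (b ∸ a) *ₚ X^ a
  X^b = subst (λ n → X^ n ≋ X^ (b ∸ a) *ₚ X^ a) (ℕ.m∸n+n≡m a≤b) (X^-+ (b ∸ a) a)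
  regroup : ∀ p w v →
            p *ₚ (w *ₚ v +ₚ oneₚ) +ₚ w *ₚ (v *ₚ p) ≋ p +ₚ ((w *ₚ v) *ₚ p +ₚ (w *ₚ v) *ₚ p)
  regroup = solve-∀ F₂[x]-solver

+-∣-eval-+ : ∀ φ u v → u +ₚ v ∣ᵖ eval φ u +ₚ eval φ v
+-∣-eval-+ []      u v = mk∣ [] (*-zeroʳ (u +ₚ v))
+-∣-eval-+ (a ∷ φ) u v = ∣ᵖ-resp-≋ expansion
  (∣ᵖ-+ (∣ᵖ-* (u +ₚ v) U) (∣ᵖ-resp-≋ (*-comm _ v) (∣ᵖ-trans (+-∣-eval-+ φ u v) (∣ᵖ-* _ v))))
  where
  U = eval φ u
  V = eval φ v
  regroup : ∀ a u v U V → ((a +ₚ u *ₚ U) +ₚ (a +ₚ v *ₚ V)) +ₚ (v *ₚ U +ₚ v *ₚ U)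
                          ≋ ((u +ₚ v) *ₚ U +ₚ v *ₚ (U +ₚ V)) +ₚ (a +ₚ a)
  regroup = solve-∀ F₂[x]-solver
  expansion : (u +ₚ v) *ₚ U +ₚ v *ₚ (U +ₚ V) ≋ eval (a ∷ φ) u +ₚ eval (a ∷ φ) v
  expansion = begin
    (u +ₚ v) *ₚ U +ₚ v *ₚ (U +ₚ V)                                 ≈⟨ +-double _ (a ∷ []) ⟨
    ((u +ₚ v) *ₚ U +ₚ v *ₚ (U +ₚ V)) +ₚ ((a ∷ []) +ₚ (a ∷ []))      ≈⟨ regroup (a ∷ []) u v U V ⟨
    (eval (a ∷ φ) u +ₚ eval (a ∷ φ) v) +ₚ (v *ₚ U +ₚ v *ₚ U)        ≈⟨ +-double _ (v *ₚ U) ⟩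
    eval (a ∷ φ) u +ₚ eval (a ∷ φ) v                               ∎

-- Φ p = 1 + x + ⋯ + x^(p-1), the p-th cyclotomic polynomial when p is prime.
Φ : ℕ → Poly
Φ p = replicate p true

xm-1-1*Φ : ∀ p → xm-1 1 *ₚ Φ p ≋ xm-1 p
xm-1-1*Φ zero    = ≋-trans (*-zeroʳ (xm-1 1)) (≋-sym (false∷-≋[] ≋-refl))
xm-1-1*Φ (suc p) = begin
  xm-1 1 *ₚ (oneₚ +ₚ (false ∷ Φ p))
    ≈⟨ *-congʳ (xm-1 1) (+-cong (≋-refl {oneₚ}) (≋-sym (x*≋false∷ (Φ p)))) ⟩
  xm-1 1 *ₚ (oneₚ +ₚ X^ 1 *ₚ Φ p)          ≈⟨ expand (X^ 1) (Φ p) ⟩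
  xm-1 1 +ₚ X^ 1 *ₚ (xm-1 1 *ₚ Φ p)        ≈⟨ +-cong (≋-refl {xm-1 1}) (*-congʳ (X^ 1) (xm-1-1*Φ p)) ⟩
  xm-1 1 +ₚ X^ 1 *ₚ xm-1 p                 ≈⟨ collect (X^ 1) (X^ p) ⟩
  (X^ 1 *ₚ X^ p +ₚ oneₚ) +ₚ (X^ 1 +ₚ X^ 1) ≈⟨ +-double _ (X^ 1) ⟩
  X^ 1 *ₚ X^ p +ₚ oneₚ                     ≈⟨ +-cong (≋-sym (X^-+ 1 p)) (≋-refl {oneₚ}) ⟩
  xm-1 (suc p)                             ∎
  where
  x*≋false∷ : ∀ q → X^ 1 *ₚ q ≋ false ∷ q
  x*≋false∷ q = ≋-trans (false∷-* oneₚ q) (∷-cong refl (*-identityˡ q))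
  expand : ∀ u q → (u +ₚ oneₚ) *ₚ (oneₚ +ₚ u *ₚ q) ≋ (u +ₚ oneₚ) +ₚ u *ₚ ((u +ₚ oneₚ) *ₚ q)
  expand = solve-∀ F₂[x]-solver
  collect : ∀ u v → (u +ₚ oneₚ) +ₚ u *ₚ (v +ₚ oneₚ) ≋ (u *ₚ v +ₚ oneₚ) +ₚ (u +ₚ u)
  collect = solve-∀ F₂[x]-solver

record Leading (p : Poly) (d : ℕ) : Set where
  constructor leading
  field
    top   : coeff p d ≡ true
    above : ∀ {i} → d < i → coeff p i ≡ false

Leading-resp-≋ : ∀ {p q d} → p ≋ q → Leading p d → Leading q d
Leading-resp-≋ (mk≋ e) (leading top above) = leading (trans (sym (e _)) top) λ d<i → trans (sym (e _)) (above d<i)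

Leading-∷ : ∀ {a p d} → Leading p d → Leading (a ∷ p) (suc d)
Leading-∷ (leading top above) = leading top λ { {suc i} (s≤s d<i) → above d<i }

Leading-∷⁻ : ∀ {a p d} → Leading (a ∷ p) (suc d) → Leading p d
Leading-∷⁻ (leading top above) = leading top λ d<i → above (s≤s d<i)

Leading-one : Leading oneₚ 0
Leading-one = leading refl λ { {suc i} _ → refl }

Leading-X^-* : ∀ {q d} g → Leading q d → Leading (X^ g *ₚ q) (g + d)
Leading-X^-* {q} zero    l = Leading-resp-≋ (≋-sym (*-identityˡ q)) l
Leading-X^-* {q} (suc g) l = Leading-resp-≋ (≋-sym (false∷-* (X^ g) q)) (Leading-∷ (Leading-X^-* g l))

Leading-const-+ : ∀ {a p d} → Leading p (suc d) → Leading ((a ∷ []) +ₚ p) (suc d)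
Leading-const-+ {p = []}    (leading () _)
Leading-const-+ {p = b ∷ p} l = Leading-∷ (Leading-∷⁻ l)

Leading-eval-X^ : ∀ φ {d} g → Leading φ d → Leading (eval φ (X^ (suc g))) (d * suc g)
Leading-eval-X^ []      g (leading () _)
Leading-eval-X^ (a ∷ φ) {zero} g (leading refl above) = Leading-resp-≋ (≋-sym (≋-trans
    (+-cong (≋-refl {oneₚ}) (≋-trans (*-congʳ (X^ (suc g)) (eval-≋[] (X^ (suc g)) φ≋[])) (*-zeroʳ (X^ (suc g)))))
    (+-identityʳ oneₚ)))
  Leading-one
  where φ≋[] : φ ≋ []
        φ≋[] = mk≋ λ n → above (s≤s z≤n)
Leading-eval-X^ (a ∷ φ) {suc d} g l = Leading-const-+ (Leading-X^-* (suc g) (Leading-eval-X^ φ g (Leading-∷⁻ l)))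

Leading-Φ : ∀ n → Leading (Φ (suc n)) n
Leading-Φ zero    = Leading-one
Leading-Φ (suc n) = Leading-∷ (Leading-Φ n)

leading-or-≋[] : ∀ p → p ≋ [] ⊎ Σ ℕ (Leading p)
leading-or-≋[] []      = inj₁ ≋-refl
leading-or-≋[] (a ∷ p) with leading-or-≋[] p
leading-or-≋[] (a ∷ p)     | inj₂ (d , l) = inj₂ (suc d , Leading-∷ l)
leading-or-≋[] (true ∷ p)  | inj₁ p≋[]    = inj₂ (0 , leading refl λ { {suc i} _ → coeff≡ p≋[] i })
leading-or-≋[] (false ∷ p) | inj₁ p≋[]    = inj₁ (false∷-≋[] p≋[])

coeff-*-Leading : ∀ {p q i j} → Leading p i → Leading q j → coeff (p *ₚ q) (i + j) ≡ true
coeff-*-Leading {[]}    (leading () _)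
coeff-*-Leading {a ∷ p} {q} {zero} {j} (leading top above) (leading topq _) =
  trans (coeff-+ (scale a q) (false ∷ p *ₚ q) j)
        (cong₂ _xor_ (trans (coeff-scale a q j) (cong₂ _∧_ top topq)) (coeff≡ (false∷-≋[] (*-congˡ q p≋[])) j))
  where p≋[] : p ≋ []
        p≋[] = mk≋ λ n → above (s≤s z≤n)
coeff-*-Leading {a ∷ p} {q} {suc i} {j} l lq@(leading _ aboveq) =
  trans (coeff-+ (scale a q) (false ∷ p *ₚ q) (suc (i + j)))
        (cong₂ _xor_ (trans (coeff-scale a q (suc (i + j))) (trans (cong (a ∧_) q-above) (∧-zeroʳ a)))
                     (coeff-*-Leading (Leading-∷⁻ l) lq))
  where q-above = aboveq (s≤s (ℕ.m≤n+m j i))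

Leading-nonunit : ∀ {d n} → Leading d (suc n) → ¬ (d ∣ᵖ oneₚ)
Leading-nonunit {d} l (mk∣ r e) with leading-or-≋[] r
... | inj₁ r≋[] with trans (sym (coeff≡ e 0)) (coeff≡ (≋-trans (*-congʳ d r≋[]) (*-zeroʳ d)) 0)
...   | ()
Leading-nonunit {d} {n} l (mk∣ r e) | inj₂ (j , lr)
  with trans (sym (coeff-*-Leading l lr)) (coeff≡ e (suc (n + j)))
...   | ()

-- Coprimality of Φ p (x^k) and x^m + 1

-- gcd m k ∣ gcd m (p * k) ∣ p * gcd m k, so the two gcds differ by the factor p.
gcd[m,p*k]≢gcd[m,k]⇒ : ∀ {p} m k → Prime p → gcd m (p * k) ≢ gcd m k →
              0 < gcd m k × p * gcd m k ∣ℕ m × ¬ (p * gcd m k ∣ℕ k)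
gcd[m,p*k]≢gcd[m,k]⇒ {p} m k pr h≢g = ℕ.n≢0⇒n>0 g≢0 , pg∣m , pg∤k
  where
  g = gcd m k
  h = gcd m (p * k)
  g∣h : g ∣ℕ h
  g∣h = gcd-greatest (gcd[m,n]∣m m k) (∣-trans (gcd[m,n]∣n m k) (n∣m*n p))
  h∣pg : h ∣ℕ p * g
  h∣pg = subst (h ∣ℕ_) (sym (c*gcd[m,n]≡gcd[cm,cn] p m k))
    (gcd-greatest (∣-trans (gcd[m,n]∣m m (p * k)) (n∣m*n p)) (gcd[m,n]∣n m (p * k)))
  g≢0 : g ≢ 0
  g≢0 g≡0 = h≢g (trans (0∣⇒≡0 (subst (_∣ℕ h) g≡0 g∣h)) (sym g≡0))
  instance
    g-nonZero : NonZero g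
    g-nonZero = ≢-nonZero g≢0
  pg∣m : p * g ∣ℕ m
  pg∣m with g∣h
  ... | divides t h≡tg with prime⇒irreducible pr {t} (*-cancelʳ-∣ g (subst (_∣ℕ p * g) h≡tg h∣pg))
  ...   | inj₁ refl = ⊥-elim (h≢g (trans h≡tg (ℕ.*-identityˡ g)))
  ...   | inj₂ refl = subst (_∣ℕ m) h≡tg (gcd[m,n]∣m m (p * k))
  pg∤k : ¬ (p * g ∣ℕ k)
  pg∤k pg∣k = ℕ.<⇒≱ (subst (g <_) (ℕ.*-comm g p) (ℕ.m<m*n g p (nonTrivial⇒n>1 p {{prime⇒nonTrivial pr}})))
                    (∣⇒≤ (gcd-greatest pg∣m pg∣k))

X^-+-X^ : ∀ a b → X^ (a + b) +ₚ X^ a ≋ X^ a *ₚ xm-1 b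
X^-+-X^ a b = ≋-trans (+-cong (X^-+ a b) ≋-refl) (factor (X^ a) (X^ b))
  where factor : ∀ u v → u *ₚ v +ₚ u ≋ u *ₚ (v +ₚ oneₚ)
        factor = solve-∀ F₂[x]-solver

Φ∘X^-∣-xm-1 : ∀ p g → eval (Φ p) (X^ g) ∣ᵖ xm-1 (p * g)
Φ∘X^-∣-xm-1 p g = mk∣ (eval (xm-1 1) (X^ g)) (begin
  eval (Φ p) (X^ g) *ₚ eval (xm-1 1) (X^ g) ≈⟨ *-comm (eval (Φ p) (X^ g)) _ ⟩
  eval (xm-1 1) (X^ g) *ₚ eval (Φ p) (X^ g) ≈⟨ ≋-sym (eval-* (xm-1 1) (Φ p) (X^ g)) ⟩
  eval (xm-1 1 *ₚ Φ p) (X^ g)              ≈⟨ eval-congˡ (X^ g) (xm-1-1*Φ p) ⟩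
  eval (xm-1 p) (X^ g)                     ≈⟨ eval-xm-1-X^ p g ⟩
  xm-1 (p * g)                             ∎)

-- With r = (k / g) mod p ≠ 0, x^k ≡ x^(rg) modulo x^(pg) + 1, a multiple of Φ p (x^g).
Φ∘X^-∣ : ∀ {p g k} .{{_ : NonZero p}} → (∀ r → 0 < r → r < p → Φ p ∣ᵖ eval (Φ p) (X^ r)) →
              g ∣ℕ k → ¬ (p * g ∣ℕ k) → eval (Φ p) (X^ g) ∣ᵖ eval (Φ p) (X^ k)
Φ∘X^-∣ {p} {g} {k} Φ∣Φ∘X^ (divides k' k≡k'g) pg∤k =
  ∣ᵖ-resp-≋ (+-cancelʳ (Φ∘ (X^ k)) (Φ∘ (X^ (r * g))))
    (∣ᵖ-+ (∣ᵖ-trans D∣X^k+X^rg (+-∣-eval-+ (Φ p) (X^ k) (X^ (r * g)))) D∣Φ∘X^rg)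
  where
  Φ∘ : Poly → Poly
  Φ∘ = eval (Φ p)
  D = Φ∘ (X^ g)
  r = k' % p
  q = k' / p
  r≢0 : r ≢ 0
  r≢0 r≡0 = pg∤k (subst (p * g ∣ℕ_) (sym k≡k'g) (*-monoˡ-∣ g (m%n≡0⇒n∣m k' p r≡0)))
  k≡rg+qpg : k ≡ r * g + (q * p) * g
  k≡rg+qpg = trans k≡k'g (trans (cong (_* g) (m≡m%n+[m/n]*n k' p)) (ℕ.*-distribʳ-+ g r (q * p)))
  D∣X^k+X^rg : D ∣ᵖ X^ k +ₚ X^ (r * g)
  D∣X^k+X^rg = ∣ᵖ-resp-≋ (≋-sym X^k+X^rg)
    (∣ᵖ-trans (∣ᵖ-trans (Φ∘X^-∣-xm-1 p g) (xm-1-∣ (*-monoˡ-∣ g (n∣m*n q {p}))))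
              (mk∣ (X^ (r * g)) (*-comm (xm-1 ((q * p) * g)) _)))
    where
    X^k+X^rg : X^ k +ₚ X^ (r * g) ≋ X^ (r * g) *ₚ xm-1 ((q * p) * g)
    X^k+X^rg = subst (λ n → X^ n +ₚ X^ (r * g) ≋ X^ (r * g) *ₚ xm-1 ((q * p) * g)) (sym k≡rg+qpg)
                     (X^-+-X^ (r * g) ((q * p) * g))
  D∣Φ∘X^rg : D ∣ᵖ Φ∘ (X^ (r * g))
  D∣Φ∘X^rg = ∣ᵖ-resp-≋ (≋-trans (eval-eval (Φ p) (X^ r) (X^ g)) (eval-congʳ (Φ p) (eval-X^-X^ r g)))
    (∣ᵖ-eval (X^ g) (Φ∣Φ∘X^ r (ℕ.n≢0⇒n>0 r≢0) (m%n<n k' p)))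

Φ∘X^-unit : ∀ {p} m k → oneₚ ∈⟨ xm-1 1 , Φ p ⟩ → gcd m (p * k) ≡ gcd m k →
                 oneₚ ∈⟨ xm-1 m , eval (Φ p) (X^ k) ⟩
Φ∘X^-unit {p} m k Φ-unit gcd≡ = ∈⟨⟩-transˡ one∈⟨xm-1k,Φy⟩ xm-1k∈⟨xm-1m,Φy⟩
  where
  one∈⟨xm-1k,Φy⟩ : oneₚ ∈⟨ xm-1 k , eval (Φ p) (X^ k) ⟩
  one∈⟨xm-1k,Φy⟩ = ∈⟨⟩-resp-≋ (eval-const true (X^ k))
    (∈⟨⟩-resp-≋ˡ (subst (λ n → eval (xm-1 1) (X^ k) ≋ xm-1 n) (ℕ.*-identityˡ k) (eval-xm-1-X^ 1 k))
      (∈⟨⟩-eval (X^ k) Φ-unit))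
  xm-1k∈⟨xm-1m,xm-1pk⟩ : xm-1 k ∈⟨ xm-1 m , xm-1 (p * k) ⟩
  xm-1k∈⟨xm-1m,xm-1pk⟩ =
    ∈⟨⟩-∣ᵖ (subst (λ n → xm-1 n ∈⟨ xm-1 m , xm-1 (p * k) ⟩) gcd≡ (xm-1-gcd m (p * k))) (xm-1-∣ (gcd[m,n]∣n m k))
  xm-1k∈⟨xm-1m,Φy⟩ : xm-1 k ∈⟨ xm-1 m , eval (Φ p) (X^ k) ⟩
  xm-1k∈⟨xm-1m,Φy⟩ = ∈⟨⟩-∣ʳ (Φ∘X^-∣-xm-1 p k) xm-1k∈⟨xm-1m,xm-1pk⟩

Φ∘X^-nonunit : ∀ {p g} → 1 < p → 0 < g → ¬ (eval (Φ p) (X^ g) ∣ᵖ oneₚ)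
Φ∘X^-nonunit {suc zero}    (s≤s ())
Φ∘X^-nonunit {suc (suc p)} {suc g} _ _ = Leading-nonunit (Leading-eval-X^ (Φ (suc (suc p))) g (Leading-Φ (suc p)))

coprime⇒gcd[m,p*k]≡gcd[m,k] : ∀ {p F P} m k → Prime p → (∀ r → 0 < r → r < p → Φ p ∣ᵖ eval (Φ p) (X^ r)) →
  Φ p ∣ᵖ F → P ∈⟨ xm-1 m , eval F (X^ k) ⟩ → GcdOne P (xm-1 m) → gcd m (p * k) ≡ gcd m k
coprime⇒gcd[m,p*k]≡gcd[m,k] {p} {F} {P} m k pr Φ∣Φ∘X^ Φ∣F P∈ coprime with gcd m (p * k) ≟ gcd m k
... | yes gcd≡ = gcd≡
... | no  gcd≢ = ⊥-elim (Φ∘X^-nonunit (nonTrivial⇒n>1 p {{prime⇒nonTrivial pr}}) 0<g D∣1)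
  where
  instance
    p-nonZero : NonZero p
    p-nonZero = prime⇒nonZero pr
  g = gcd m k
  split = gcd[m,p*k]≢gcd[m,k]⇒ m k pr gcd≢
  0<g = proj₁ split
  D = eval (Φ p) (X^ g)
  D∣xm-1 : D ∣ᵖ xm-1 m
  D∣xm-1 = ∣ᵖ-trans (Φ∘X^-∣-xm-1 p g) (xm-1-∣ (proj₁ (proj₂ split)))
  D∣F∘y : D ∣ᵖ eval F (X^ k)
  D∣F∘y = ∣ᵖ-trans (Φ∘X^-∣ Φ∣Φ∘X^ (gcd[m,n]∣n m k) (proj₂ (proj₂ split))) (∣ᵖ-eval (X^ k) Φ∣F)
  D∣1 : D ∣ᵖ oneₚ
  D∣1 = ∣ₚ⇒∣ᵖ (coprime D (∣ᵖ⇒∣ₚ (∣ᵖ-∈⟨⟩ D∣xm-1 D∣F∘y P∈)) (∣ᵖ⇒∣ₚ D∣xm-1))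

-- The polynomial c

c : ℕ → Poly
c = cPoly (2 ∷ 3 ∷ 4 ∷ 7 ∷ [])

c₀ q₀ f : Poly
c₀ = (((oneₚ +ₚ X^ 7) +ₚ X^ 4) +ₚ X^ 3) +ₚ X^ 2
q₀ = ((oneₚ +ₚ X^ 3) +ₚ X^ 4) +ₚ X^ 5
f  = Φ 3 *ₚ (Φ 5 *ₚ (Φ 5 *ₚ Φ 5))

c-split : ∀ t → c (7 + t) ≋ c₀ +ₚ q₀ *ₚ X^ t
c-split t = ≋-trans
  (+-cong (+-cong (+-cong (≋-refl {oneₚ +ₚ (X^ 7 +ₚ X^ t)}) (+-cong (≋-refl {X^ 4}) (X^-+ 3 t)))
                  (+-cong (≋-refl {X^ 3}) (X^-+ 4 t)))
          (+-cong (≋-refl {X^ 2}) (X^-+ 5 t)))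
  (regroup (X^ 7) (X^ 4) (X^ 3) (X^ 2) (X^ 5) (X^ t))
  where
  regroup : ∀ x⁷ x⁴ x³ x² x⁵ u →
    (((oneₚ +ₚ (x⁷ +ₚ u)) +ₚ (x⁴ +ₚ x³ *ₚ u)) +ₚ (x³ +ₚ x⁴ *ₚ u)) +ₚ (x² +ₚ x⁵ *ₚ u)
      ≋ ((((oneₚ +ₚ x⁷) +ₚ x⁴) +ₚ x³) +ₚ x²) +ₚ (((oneₚ +ₚ x³) +ₚ x⁴) +ₚ x⁵) *ₚ u
  regroup = solve-∀ F₂[x]-solver

X^7*c₀+f≋q₀ : X^ 7 *ₚ c₀ +ₚ f ≋ q₀
X^7*c₀+f≋q₀ = ≋-by-evaluation (X^ 7 *ₚ c₀ +ₚ f) q₀ tt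

X^7*c+f : ∀ t → X^ 7 *ₚ c (7 + t) +ₚ f ≋ q₀ *ₚ xm-1 (7 + t)
X^7*c+f t = begin
  X^ 7 *ₚ c (7 + t) +ₚ f                    ≈⟨ +-cong (*-congʳ (X^ 7) (c-split t)) (≋-refl {f}) ⟩
  X^ 7 *ₚ (c₀ +ₚ q₀ *ₚ X^ t) +ₚ f           ≈⟨ regroup (X^ 7) c₀ q₀ (X^ t) f ⟩
  (X^ 7 *ₚ c₀ +ₚ f) +ₚ q₀ *ₚ (X^ 7 *ₚ X^ t) ≈⟨ +-cong X^7*c₀+f≋q₀ (*-congʳ q₀ (≋-sym (X^-+ 7 t))) ⟩
  q₀ +ₚ q₀ *ₚ X^ (7 + t)                    ≈⟨ factor q₀ (X^ (7 + t)) ⟩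
  q₀ *ₚ xm-1 (7 + t)                        ∎
  where
  regroup : ∀ x⁷ c₀ q₀ u f → x⁷ *ₚ (c₀ +ₚ q₀ *ₚ u) +ₚ f ≋ (x⁷ *ₚ c₀ +ₚ f) +ₚ q₀ *ₚ (x⁷ *ₚ u)
  regroup = solve-∀ F₂[x]-solver
  factor : ∀ q v → q +ₚ q *ₚ v ≋ q *ₚ (v +ₚ oneₚ)
  factor = solve-∀ F₂[x]-solver

X^7*c+f∘X^ : ∀ t k → X^ (7 * k) *ₚ eval (c (7 + t)) (X^ k) +ₚ eval f (X^ k)
                     ≋ eval q₀ (X^ k) *ₚ xm-1 ((7 + t) * k)
X^7*c+f∘X^ t k = begin
  X^ (7 * k) *ₚ cy +ₚ fy        ≈⟨ +-cong (*-congˡ cy (≋-sym (eval-X^-X^ 7 k))) (≋-refl {fy}) ⟩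
  eval (X^ 7) y *ₚ cy +ₚ fy     ≈⟨ +-cong (≋-sym (eval-* (X^ 7) (c m) y)) (≋-refl {fy}) ⟩
  eval (X^ 7 *ₚ c m) y +ₚ fy    ≈⟨ ≋-sym (eval-+ (X^ 7 *ₚ c m) f y) ⟩
  eval (X^ 7 *ₚ c m +ₚ f) y     ≈⟨ eval-congˡ y (X^7*c+f t) ⟩
  eval (q₀ *ₚ xm-1 m) y         ≈⟨ eval-* q₀ (xm-1 m) y ⟩
  eval q₀ y *ₚ eval (xm-1 m) y  ≈⟨ *-congʳ (eval q₀ y) (eval-xm-1-X^ m k) ⟩
  eval q₀ y *ₚ xm-1 (m * k)     ∎
  where
  m = 7 + t
  y = X^ k
  cy = eval (c m) y
  fy = eval f y

c∘X^∈⟨xm-1,f∘X^⟩ : ∀ t k → eval (c (7 + t)) (X^ k) ∈⟨ xm-1 (7 + t) , eval f (X^ k) ⟩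
c∘X^∈⟨xm-1,f∘X^⟩ t k = ∈⟨⟩-∣ˡ (xm-1-∣ (m∣m*n k)) (∈⟨⟩-transʳ (X^-unit cy 7k≤mk) X^7k*cy∈)
  where
  cy = eval (c (7 + t)) (X^ k)
  7k≤mk : 7 * k ≤ (7 + t) * k
  7k≤mk = ℕ.*-monoˡ-≤ k (ℕ.m≤m+n 7 t)
  X^7k*cy∈ : X^ (7 * k) *ₚ cy ∈⟨ xm-1 ((7 + t) * k) , eval f (X^ k) ⟩
  X^7k*cy∈ = +≋*⇒∈⟨⟩ {r = eval q₀ (X^ k)} (X^7*c+f∘X^ t k)

f∘X^∈⟨xm-1,c∘X^⟩ : ∀ t k → eval f (X^ k) ∈⟨ xm-1 (7 + t) , eval (c (7 + t)) (X^ k) ⟩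
f∘X^∈⟨xm-1,c∘X^⟩ t k = ∈⟨⟩-∣ˡ (xm-1-∣ (m∣m*n k)) (∈⟨⟩-∣ʳ (mk∣ (X^ (7 * k)) (*-comm cy (X^ (7 * k)))) fy∈)
  where
  cy = eval (c (7 + t)) (X^ k)
  fy = eval f (X^ k)
  fy∈ : fy ∈⟨ xm-1 ((7 + t) * k) , X^ (7 * k) *ₚ cy ⟩
  fy∈ = +≋*⇒∈⟨⟩ {r = eval q₀ (X^ k)} (≋-trans (+-comm fy (X^ (7 * k) *ₚ cy)) (X^7*c+f∘X^ t k))

Φ₃∣Φ₃∘X^ : ∀ r → 0 < r → r < 3 → Φ 3 ∣ᵖ eval (Φ 3) (X^ r)
Φ₃∣Φ₃∘X^ 1 _ _ = mk∣ oneₚ  (≋-by-evaluation _ _ tt)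
Φ₃∣Φ₃∘X^ 2 _ _ = mk∣ (Φ 3) (≋-by-evaluation _ _ tt)
Φ₃∣Φ₃∘X^ (suc (suc (suc r))) _ (s≤s (s≤s (s≤s ())))

Φ₅∣Φ₅∘X^ : ∀ r → 0 < r → r < 5 → Φ 5 ∣ᵖ eval (Φ 5) (X^ r)
Φ₅∣Φ₅∘X^ 1 _ _ = mk∣ oneₚ  (≋-by-evaluation _ _ tt)
Φ₅∣Φ₅∘X^ 2 _ _ = mk∣ (Φ 5) (≋-by-evaluation _ _ tt)
Φ₅∣Φ₅∘X^ 3 _ _ = mk∣ (true ∷ true ∷ false ∷ true ∷ true ∷ true ∷ false ∷ true ∷ true ∷ [])
                     (≋-by-evaluation _ _ tt)
Φ₅∣Φ₅∘X^ 4 _ _ = mk∣ (true ∷ true ∷ false ∷ false ∷ true ∷ false ∷ true ∷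
                      false ∷ true ∷ false ∷ false ∷ true ∷ true ∷ [])
                     (≋-by-evaluation _ _ tt)
Φ₅∣Φ₅∘X^ (suc (suc (suc (suc (suc r))))) _ (s≤s (s≤s (s≤s (s≤s (s≤s ())))))

Φ₃-unit : oneₚ ∈⟨ xm-1 1 , Φ 3 ⟩
Φ₃-unit = mk∈ (X^ 1) oneₚ (≋-by-evaluation _ _ tt)

Φ₅-unit : oneₚ ∈⟨ xm-1 1 , Φ 5 ⟩
Φ₅-unit = mk∈ (X^ 1 +ₚ X^ 3) oneₚ (≋-by-evaluation _ _ tt)

Φ₃∣f : Φ 3 ∣ᵖ f
Φ₃∣f = ∣ᵖ-* (Φ 3) (Φ 5 *ₚ (Φ 5 *ₚ Φ 5))

Φ₅∣f : Φ 5 ∣ᵖ f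
Φ₅∣f = mk∣ (Φ 3 *ₚ (Φ 5 *ₚ Φ 5)) (≋-by-evaluation _ _ tt)

eval-f : ∀ y → eval f y ≋ eval (Φ 3) y *ₚ (eval (Φ 5) y *ₚ (eval (Φ 5) y *ₚ eval (Φ 5) y))
eval-f y = ≋-trans (eval-* (Φ 3) (Φ 5 *ₚ (Φ 5 *ₚ Φ 5)) y) (*-congʳ (eval (Φ 3) y)
  (≋-trans (eval-* (Φ 5) (Φ 5 *ₚ Φ 5) y) (*-congʳ (eval (Φ 5) y) (eval-* (Φ 5) (Φ 5) y))))

prime₃ : Prime 3
prime₃ = from-yes (prime? 3)

prime₅ : Prime 5
prime₅ = from-yes (prime? 5)

f∘X^-unit : ∀ m k → gcd m (3 * k) ≡ gcd m k → gcd m (5 * k) ≡ gcd m k →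
            oneₚ ∈⟨ xm-1 m , eval f (X^ k) ⟩
f∘X^-unit m k gcd₃ gcd₅ =
  ∈⟨⟩-resp-≋ʳ (≋-sym (eval-f (X^ k))) (∈⟨⟩-one-* u₃ (∈⟨⟩-one-* u₅ (∈⟨⟩-one-* u₅ u₅)))
  where
  u₃ = Φ∘X^-unit m k Φ₃-unit gcd₃
  u₅ = Φ∘X^-unit m k Φ₅-unit gcd₅

proposition6 : (m k : ℕ) → 15 ≤ m → 1 ≤ k →
    GcdOne (eval (cPoly (2 ∷ 3 ∷ 4 ∷ 7 ∷ []) m) (X^ k)) (xm-1 m)
      ⇔ (gcd m (3 * k) ≡ gcd m k × gcd m (5 * k) ≡ gcd m k)
proposition6 .(7 + t) k (s≤s (s≤s (s≤s (s≤s (s≤s (s≤s (s≤s {n = t} _))))))) _ = mk⇔ forward backward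
  where
  m = 7 + t
  cy = eval (c m) (X^ k)
  forward : GcdOne cy (xm-1 m) → gcd m (3 * k) ≡ gcd m k × gcd m (5 * k) ≡ gcd m k
  forward coprime = coprime⇒gcd[m,p*k]≡gcd[m,k] m k prime₃ Φ₃∣Φ₃∘X^ Φ₃∣f c∈ coprime
                  , coprime⇒gcd[m,p*k]≡gcd[m,k] m k prime₅ Φ₅∣Φ₅∘X^ Φ₅∣f c∈ coprime
    where c∈ = c∘X^∈⟨xm-1,f∘X^⟩ t k
  backward : gcd m (3 * k) ≡ gcd m k × gcd m (5 * k) ≡ gcd m k → GcdOne cy (xm-1 m)
  backward (gcd₃ , gcd₅) = ∈⟨⟩⇒GcdOne (∈⟨⟩-transʳ (f∘X^-unit m k gcd₃ gcd₅) (f∘X^∈⟨xm-1,c∘X^⟩ t k))
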